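{- Let $n\ge 1$, let $\mathcal{X}\subseteq\{\pm1\}^n$ be a multiset of size $q$, and suppose that a vector $(X_1,\ldots,X_n)$ drawn uniformly from $\mathcal{X}$ is $\varepsilon$-biased. Then the entropy $H:=\log_2 q$ satisfies $H\geq\min\{\log(1/\varepsilon),\,n-1\}$.
   Context: A sequence $\{X_i\}_{i=1}^n$ of random variables taking values in $\{\pm1\}$ is called $\varepsilon$-biased if $\left|\mathbb{E}\prod_{i\in I}X_i\right|\le\varepsilon$ for every nonempty $I\subseteq\{1,\ldots,n\}$. A multiset $\mathcal{X}$ with this property for the uniform distribution is called an $\varepsilon$-biased set, and its entropy is $\log_2|\mathcal{X}|$ (counting multiplicity).
   Formalization: The bias bound ε is rational, and log is the logarithm to base 2. -}

module Defs where

open import Data.Nat using (ℕ; zero; suc; NonZero)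
open import Data.Integer using (ℤ; +_; -[1+_]; _*_; _+_)
open import Data.Fin using (Fin; zero; suc)
open import Data.Fin.Subset using (Subset; Nonempty)
open import Data.Vec using ([]; _∷_)
open import Data.Bool using (Bool; true; false; if_then_else_)
open import Data.Rational using (ℚ; _/_; ∣_∣; _≤_)
open import Data.Product using (_×_)

-- A point of {±1}^n: coordinate i is  +1  (false) or  -1  (true).
PM : ℕ → Set
PM n = Fin n → Bool

sgn : Bool → ℤ
sgn false = + 1
sgn true  = -[1+ 0 ]

prodOver : ∀ {n} → Subset n → PM n → ℤ
prodOver [] x = + 1
prodOver (b ∷ I) x = (if b then sgn (x zero) else + 1) * prodOver I (λ i → x (suc i))

sumFin : ∀ {q} → (Fin q → ℤ) → ℤ
sumFin {zero} f = + 0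
sumFin {suc q} f = f zero + sumFin (λ j → f (suc j))

-- A multiset of size q in {±1}^n, given as an enumeration of its q elements
-- (with repetition).  Expectation under the uniform distribution.
expect : ∀ {q} → .{{NonZero q}} → (Fin q → ℤ) → ℚ
expect {q} f = sumFin f / q

EpsBiased : ∀ {n q} → .{{NonZero q}} → ℚ → (Fin q → PM n) → Set
EpsBiased {n} ε 𝒳 = (I : Subset n) → Nonempty I → ∣ expect (λ j → prodOver I (𝒳 j)) ∣ ≤ ε

module Submission where

-- Call a finite list L of points of {±1}^n *balanced* if every
-- nonempty character sum  Σ_{x ∈ L} ∏_{i ∈ I} x_i  vanishes, i.e. the
-- uniform distribution on L is 0-biased.  The combinatorial heart is:
--
--   a nonempty balanced list in {±1}^n has at least 2^n elements.
--
-- Proof by induction on n: split L by its first coordinate into the fibres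
-- L₊ and L₋ (first coordinate dropped).  The character sums of L over
-- (outside ∷ J) and (inside ∷ J) are the sum and the difference of those of
-- L₊ and L₋ over J.  Balance of L thus forces |L₊| = |L₋| (take J = ∅) and
-- makes L₊ balanced, so the induction hypothesis gives |L| = 2|L₊| ≥ 2^n.
--
-- The theorem follows by cases: if some nonempty character sum s of 𝒳 is
-- nonzero then ε ≥ |s|/q ≥ 1/q, i.e. q·ε ≥ 1; otherwise 𝒳 is balanced and
-- q ≥ 2^n ≥ 2^(n-1).

open import Defs
open import Data.Nat using (ℕ; suc; _^_; _∸_; NonZero)
open import Data.Integer using (+_)
open import Data.Fin using (Fin)
open import Data.Rational using (ℚ; _/_; _*_; 1ℚ)
open import Data.Sum using (_⊎_)

open import Data.Nat as ℕ using (zero; z≤n; s≤s)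
import Data.Nat.Properties as ℕP
open import Data.Integer as ℤ using (ℤ; -[1+_]; 0ℤ)
import Data.Integer.Properties as ℤP
open import Data.Integer.Solver using (module +-*-Solver)
open import Data.Fin as Fin using ()
open import Data.Fin.Subset using (Subset; Nonempty; ⊥; inside; outside)
open import Data.Vec using (_∷_; here; there)
open import Data.List using (List; []; _∷_; length; tabulate)
open import Data.List.Properties using (length-tabulate)
open import Data.Bool using (true; false)
open import Data.Product using (_,_)
open import Data.Sum using (inj₁; inj₂)
open import Data.Empty using (⊥-elim)
open import Relation.Nullary using (yes; no; ¬_)
open import Relation.Binary.PropositionalEquality
import Data.Rational as ℚ
import Data.Rational.Properties as ℚP
import Data.Rational.Unnormalised as ℚᵘ
import Data.Rational.Unnormalised.Properties as ℚᵘP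

charSum : ∀ {n} → Subset n → List (PM n) → ℤ
charSum I []      = 0ℤ
charSum I (x ∷ L) = prodOver I x ℤ.+ charSum I L

dropFirst : ∀ {n} → PM (suc n) → PM n
dropFirst x i = x (Fin.suc i)

fibre₊ fibre₋ : ∀ {n} → List (PM (suc n)) → List (PM n)
fibre₊ [] = []
fibre₊ (x ∷ L) with x Fin.zero
... | false = dropFirst x ∷ fibre₊ L
... | true  = fibre₊ L
fibre₋ [] = []
fibre₋ (x ∷ L) with x Fin.zero
... | false = fibre₋ L
... | true  = dropFirst x ∷ fibre₋ L

length-fibres : ∀ {n} (L : List (PM (suc n))) →
                length L ≡ length (fibre₊ L) ℕ.+ length (fibre₋ L)
length-fibres [] = refl
length-fibres (x ∷ L) with x Fin.zero
... | false = cong suc (length-fibres L)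
... | true  = trans (cong suc (length-fibres L)) (sym (ℕP.+-suc _ _))

open +-*-Solver

charSum-outside : ∀ {n} (J : Subset n) L →
                  charSum (outside ∷ J) L ≡ charSum J (fibre₊ L) ℤ.+ charSum J (fibre₋ L)
charSum-outside J [] = refl
charSum-outside J (x ∷ L) with x Fin.zero
... | false rewrite charSum-outside J L =
  solve 3 (λ p a b → con (+ 1) :* p :+ (a :+ b) := (p :+ a) :+ b) refl
          (prodOver J (dropFirst x)) (charSum J (fibre₊ L)) (charSum J (fibre₋ L))
... | true rewrite charSum-outside J L =
  solve 3 (λ p a b → con (+ 1) :* p :+ (a :+ b) := a :+ (p :+ b)) refl
          (prodOver J (dropFirst x)) (charSum J (fibre₊ L)) (charSum J (fibre₋ L))

charSum-inside : ∀ {n} (J : Subset n) L →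
                 charSum (inside ∷ J) L ≡ charSum J (fibre₊ L) ℤ.- charSum J (fibre₋ L)
charSum-inside J [] = refl
charSum-inside J (x ∷ L) with x Fin.zero
... | false rewrite charSum-inside J L =
  solve 3 (λ p a b → con (+ 1) :* p :+ (a :- b) := (p :+ a) :- b) refl
          (prodOver J (dropFirst x)) (charSum J (fibre₊ L)) (charSum J (fibre₋ L))
... | true rewrite charSum-inside J L =
  solve 3 (λ p a b → con (-[1+ 0 ]) :* p :+ (a :- b) := a :- (p :+ b)) refl
          (prodOver J (dropFirst x)) (charSum J (fibre₊ L)) (charSum J (fibre₋ L))

prodOver-empty : ∀ {n} (x : PM n) → prodOver ⊥ x ≡ + 1
prodOver-empty {zero}  x = refl
prodOver-empty {suc n} x = cong (+ 1 ℤ.*_) (prodOver-empty (dropFirst x))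

charSum-empty : ∀ {n} (L : List (PM n)) → charSum ⊥ L ≡ + length L
charSum-empty [] = refl
charSum-empty (x ∷ L) = cong₂ ℤ._+_ (prodOver-empty x) (charSum-empty L)

Balanced : ∀ {n} → List (PM n) → Set
Balanced {n} L = (I : Subset n) → Nonempty I → charSum I L ≡ 0ℤ

double≡0⇒≡0 : ∀ (a : ℤ) → a ℤ.+ a ≡ 0ℤ → a ≡ 0ℤ
double≡0⇒≡0 (+ zero)  _ = refl
double≡0⇒≡0 (+ suc _) ()
double≡0⇒≡0 -[1+ _ ]  ()

extend-nonempty : ∀ {n} b {J : Subset n} → Nonempty J → Nonempty (b ∷ J)
extend-nonempty b (i , i∈J) = Fin.suc i , there i∈J

module _ {n} (L : List (PM (suc n))) (balanced : Balanced L) where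

  fibres-agree : ∀ J → Nonempty J → charSum J (fibre₊ L) ≡ charSum J (fibre₋ L)
  fibres-agree J ne = ℤP.i-j≡0⇒i≡j _ _
    (trans (sym (charSum-inside J L)) (balanced _ (extend-nonempty inside ne)))

  -- the fibres have equal size: use the character x ↦ x₀
  fibres-equal-length : length (fibre₊ L) ≡ length (fibre₋ L)
  fibres-equal-length = ℤP.+-injective (ℤP.i-j≡0⇒i≡j _ _ (begin
      + length (fibre₊ L) ℤ.- + length (fibre₋ L)
        ≡⟨ sym (cong₂ ℤ._-_ (charSum-empty (fibre₊ L)) (charSum-empty (fibre₋ L))) ⟩
      charSum ⊥ (fibre₊ L) ℤ.- charSum ⊥ (fibre₋ L)
        ≡⟨ sym (charSum-inside ⊥ L) ⟩
      charSum (inside ∷ ⊥) L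
        ≡⟨ balanced _ (Fin.zero , here) ⟩
      0ℤ ∎))
    where open ≡-Reasoning

  fibre₊-balanced : Balanced (fibre₊ L)
  fibre₊-balanced J ne = double≡0⇒≡0 _ (begin
      charSum J (fibre₊ L) ℤ.+ charSum J (fibre₊ L)
        ≡⟨ cong (λ t → charSum J (fibre₊ L) ℤ.+ t) (fibres-agree J ne) ⟩
      charSum J (fibre₊ L) ℤ.+ charSum J (fibre₋ L)
        ≡⟨ sym (charSum-outside J L) ⟩
      charSum (outside ∷ J) L
        ≡⟨ balanced _ (extend-nonempty outside ne) ⟩
      0ℤ ∎)
    where open ≡-Reasoning

equal-halves-positive : ∀ {a b} → a ≡ b → 1 ℕ.≤ a ℕ.+ b → 1 ℕ.≤ a
equal-halves-positive {zero}  refl ()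
equal-halves-positive {suc _} _    _ = s≤s z≤n

balanced-size : ∀ n (L : List (PM n)) → 1 ℕ.≤ length L → Balanced L → 2 ^ n ℕ.≤ length L
balanced-size zero    L nonempty _        = nonempty
balanced-size (suc n) L nonempty balanced = begin
    2 ^ n ℕ.+ (2 ^ n ℕ.+ 0)                 ≡⟨ cong (2 ^ n ℕ.+_) (ℕP.+-identityʳ (2 ^ n)) ⟩
    2 ^ n ℕ.+ 2 ^ n                          ≤⟨ ℕP.+-mono-≤ ih (ℕP.≤-trans ih (ℕP.≤-reflexive equal)) ⟩
    length (fibre₊ L) ℕ.+ length (fibre₋ L)  ≡⟨ sym (length-fibres L) ⟩
    length L                                 ∎
  where
  open ℕP.≤-Reasoning
  equal : length (fibre₊ L) ≡ length (fibre₋ L)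
  equal = fibres-equal-length L balanced
  -- L₊ is nonempty, since |L| = 2|L₊|
  fibre₊-nonempty : 1 ℕ.≤ length (fibre₊ L)
  fibre₊-nonempty = equal-halves-positive equal (subst (1 ℕ.≤_) (length-fibres L) nonempty)
  ih : 2 ^ n ℕ.≤ length (fibre₊ L)
  ih = balanced-size n (fibre₊ L) fibre₊-nonempty (fibre₊-balanced L balanced)

nonzero⇒∣∣≥1 : (s : ℤ) → ¬ (s ≡ 0ℤ) → + 1 ℤ.≤ + ℤ.∣ s ∣
nonzero⇒∣∣≥1 (+ zero)  s≢0 = ⊥-elim (s≢0 refl)
nonzero⇒∣∣≥1 (+ suc _) _   = ℤ.+≤+ (s≤s z≤n)
nonzero⇒∣∣≥1 -[1+ _ ]  _   = ℤ.+≤+ (s≤s z≤n)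

scaled-bound : ∀ k e d s → ¬ (s ≡ 0ℤ) → ℚᵘ.mkℚᵘ (+ ℤ.∣ s ∣) k ℚᵘ.≤ ℚᵘ.mkℚᵘ e d →
               ℚᵘ.1ℚᵘ ℚᵘ.≤ ℚᵘ.mkℚᵘ (+ suc k) 0 ℚᵘ.* ℚᵘ.mkℚᵘ e d
scaled-bound k e d s s≢0 (ℚᵘ.*≤* ∣s∣[1+d]≤e[1+k]) = ℚᵘ.*≤* (begin
    + 1 ℤ.* (+ 1 ℤ.* + suc d)    ≡⟨ ℤP.*-identityˡ _ ⟩
    + 1 ℤ.* + suc d              ≤⟨ ℤP.*-monoʳ-≤-nonNeg (+ suc d) (nonzero⇒∣∣≥1 s s≢0) ⟩
    + ℤ.∣ s ∣ ℤ.* + suc d        ≤⟨ ∣s∣[1+d]≤e[1+k] ⟩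
    e ℤ.* + suc k                ≡⟨ ℤP.*-comm e (+ suc k) ⟩
    + suc k ℤ.* e                ≡⟨ ℤP.*-identityʳ _ ⟨
    (+ suc k ℤ.* e) ℤ.* + 1      ∎)
  where open ℤP.≤-Reasoning

nonzero-mean-bound : ∀ q .{{_ : NonZero q}} (s : ℤ) (ε : ℚ) → ¬ (s ≡ 0ℤ) →
                     ℚ.∣ s / q ∣ ℚ.≤ ε → 1ℚ ℚ.≤ (+ q / 1) * ε
nonzero-mean-bound (suc k) s ε@(ℚ.mkℚ e d _) s≢0 mean≤ε =
  ℚP.toℚᵘ-cancel-≤ (ℚᵘP.≤-respʳ-≃ product-as-ℚᵘ
    (scaled-bound k e d s s≢0 (ℚᵘP.≤-respˡ-≃ mean-as-ℚᵘ (ℚP.toℚᵘ-mono-≤ mean≤ε))))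
  where
  mean-as-ℚᵘ : ℚ.toℚᵘ ℚ.∣ s / suc k ∣ ℚᵘ.≃ ℚᵘ.mkℚᵘ (+ ℤ.∣ s ∣) k
  mean-as-ℚᵘ = ℚᵘP.≃-trans (ℚP.toℚᵘ-homo-∣-∣ (s / suc k))
                           (ℚᵘP.∣-∣-cong (ℚP.toℚᵘ-fromℚᵘ (ℚᵘ.mkℚᵘ s k)))
  product-as-ℚᵘ : ℚᵘ.mkℚᵘ (+ suc k) 0 ℚᵘ.* ℚᵘ.mkℚᵘ e d ℚᵘ.≃ ℚ.toℚᵘ ((+ suc k / 1) * ε)
  product-as-ℚᵘ = ℚᵘP.≃-sym (ℚᵘP.≃-trans (ℚP.toℚᵘ-homo-* (+ suc k / 1) ε)
                    (ℚᵘP.*-congʳ (ℚP.toℚᵘ-fromℚᵘ (ℚᵘ.mkℚᵘ (+ suc k) 0))))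

sumFin-charSum : ∀ {n q} (I : Subset n) (𝒳 : Fin q → PM n) →
                 sumFin (λ j → prodOver I (𝒳 j)) ≡ charSum I (tabulate 𝒳)
sumFin-charSum {q = zero}  I 𝒳 = refl
sumFin-charSum {q = suc q} I 𝒳 =
  cong (λ t → prodOver I (𝒳 Fin.zero) ℤ.+ t) (sumFin-charSum I (λ j → 𝒳 (Fin.suc j)))

proposition2 : (n q : ℕ) → .{{_ : NonZero n}} → .{{_ : NonZero q}} → (ε : ℚ) → (𝒳 : Fin q → PM n) →
    EpsBiased ε 𝒳 → (2 ^ (n ∸ 1) Data.Nat.≤ q) ⊎ (1ℚ Data.Rational.≤ (+ q / 1) * ε)
proposition2 n q ε 𝒳 biased with 1ℚ ℚ.≤? (+ q / 1) * ε
... | yes qε≥1 = inj₂ qε≥1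
... | no  qε≱1 = inj₁ (ℕP.≤-trans (ℕP.^-monoʳ-≤ 2 (ℕP.m∸n≤m n 1))
                        (subst (2 ^ n ℕ.≤_) (length-tabulate 𝒳)
                          (balanced-size n (tabulate 𝒳) nonempty balanced)))
  where
  nonempty : 1 ℕ.≤ length (tabulate 𝒳)
  nonempty = subst (1 ℕ.≤_) (sym (length-tabulate 𝒳)) (ℕP.n≢0⇒n>0 (ℕ.≢-nonZero⁻¹ q))
  -- a nonzero character sum would give q·ε ≥ 1 by ε-bias
  balanced : Balanced (tabulate 𝒳)
  balanced I ne with charSum I (tabulate 𝒳) ℤ.≟ 0ℤ
  ... | yes sum≡0 = sum≡0
  ... | no  sum≢0 = ⊥-elim (qε≱1 (nonzero-mean-bound q _ ε
                      (λ sum≡0 → sum≢0 (trans (sym (sumFin-charSum I 𝒳)) sum≡0)) (biased I ne)))
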